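{- Let $\mathcal{F}=\langle W,R,\{S_x\}_{x\in W}\rangle$ be a Veltman frame, let $f,g,h$ be ultrafilters on $W$, and let $a,b\subseteq\wp(W)$. Then: (1) if $a\subseteq b$ and $f\prec_b g$, then $f\prec_a g$; (2) if $f\prec_a g$ and $R^{ -1}(X)\in g$ for every $X\in h$, then $f\prec_a h$.
   Context: A Veltman frame is $\langle W,R,\{S_w\}\rangle$ where: - $W$ is nonempty. - $R$ is transitive and conversely well-founded. - Each $S_w$ is a reflexive transitive relation on $R[w]=\{v:wRv\}$ containing $R\cap R[w]^2$. For $X,Y\subseteq W$: - $\overline{Y}=W\setminus Y$. - $R^{ -1}(Y)=\{w:\exists y\in Y\,wRy\}$. - $\widehat{R^{ -1}}(Y)=\{x:\forall y(xRy\to y\in Y)\}$. - $S^{ -1}(X,Y)=\{w:\forall x\in X(wRx\to\exists y\in Y\,xS_wy)\}$. For a family $l\subseteq\wp(W)$ and ultrafilters $f,g$, $f\prec_l g$ means the following: for every $A\subseteq W$ and every finite (possibly empty) family $S_1,\dots,S_n\in l$, if $S^{ -1}(\overline{A},\overline{S_1}\cup\dots\cup\overline{S_n})\in f$ then $A\in g$ and $\widehat{R^{ -1}}(A)\in g$. -}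

module Defs where

open import Level using (0ℓ)
open import Data.Product using (Σ; ∃; _×_; _,_)
open import Data.Sum using (_⊎_)
open import Data.Empty using (⊥)
open import Data.Unit using (⊤)
open import Data.List using (List; []; _∷_)
open import Data.List.Relation.Unary.All using (All)
open import Relation.Nullary using (¬_)
open import Relation.Unary using (Pred; _∈_; _⊆_; _∩_; _∪_; ∁; U; ∅)
open import Relation.Binary using (Rel; Transitive)
open import Induction.WellFounded using (WellFounded)
open import Function using (flip)

Subset : Set → Set₁
Subset W = Pred W 0ℓ

Family : Set → Set₂
Family W = Pred (Subset W) (Level.suc 0ℓ)

record VeltmanFrame : Set₁ where
  field
    W       : Set
    inhabited : W
    R       : Rel W 0ℓ
    R-trans : Transitive R
    R-cwf   : WellFounded (flip R)
    S       : W → Rel W 0ℓ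
    S-dom   : ∀ {w x y} → S w x y → R w x × R w y
    S-refl  : ∀ {w x} → R w x → S w x x
    S-trans : ∀ {w x y z} → S w x y → S w y z → S w x z
    R⊆S     : ∀ {w x y} → R w x → R w y → R x y → S w x y

record Ultrafilter (W : Set) : Set₂ where
  field
    mem      : Family W
    univ     : U ∈ mem
    proper   : ¬ (∅ ∈ mem)
    upward   : ∀ {A B : Subset W} → A ⊆ B → A ∈ mem → B ∈ mem
    meet     : ∀ {A B : Subset W} → A ∈ mem → B ∈ mem → (A ∩ B) ∈ mem
    ultra    : ∀ (A : Subset W) → (A ∈ mem) ⊎ (∁ A ∈ mem)

module Frame (F : VeltmanFrame) where
  open VeltmanFrame F

  compl : Subset W → Subset W
  compl Y = ∁ Y

  Rinv : Subset W → Subset W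
  Rinv Y w = ∃ λ y → Y y × R w y

  Rbox : Subset W → Subset W
  Rbox Y x = ∀ y → R x y → Y y

  Sinv : Subset W → Subset W → Subset W
  Sinv X Y w = ∀ x → X x → R w x → ∃ λ y → Y y × S w x y

  unionCompl : List (Subset W) → Subset W
  unionCompl []       = ∅
  unionCompl (T ∷ Ts) = compl T ∪ unionCompl Ts

  _≺[_]_ : Ultrafilter W → Family W → Ultrafilter W → Set₁
  f ≺[ l ] g =
    ∀ (A : Subset W) (Ss : List (Subset W)) → All (_∈ l) Ss →
      Sinv (compl A) (unionCompl Ss) ∈ Ultrafilter.mem f →
      (A ∈ Ultrafilter.mem g) × (Rbox A ∈ Ultrafilter.mem g)

{-# OPTIONS --safe #-}
module Submission where

open import Defs
open import Data.Product using (_×_; _,_; proj₂)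
open import Data.Sum using (inj₁; inj₂)
open import Data.Empty using (⊥-elim)
import Data.List.Relation.Unary.All as All
open import Relation.Unary using (_⊆_; _∈_; ∁; _∩_; ∅)

-- For (2), the hypothesis makes h a canonical R-successor of g, so every box \widehat{R^{-1}}(B)
-- in g puts B in h; by transitivity of R, \widehat{R^{-1}}(A) ∈ g also puts its own box in g.

module _ (F : VeltmanFrame) where
  open VeltmanFrame F
  open Frame F
  open Ultrafilter using (mem)

  _⊲_ : Ultrafilter W → Ultrafilter W → Set₁
  g ⊲ h = ∀ X → X ∈ mem h → Rinv X ∈ mem g

  Rinv∁∩Rbox⊆∅ : (B : Subset W) → Rinv (∁ B) ∩ Rbox B ⊆ ∅
  Rinv∁∩Rbox⊆∅ B ((y , y∉B , wRy) , w∈□B) = y∉B (w∈□B y wRy)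

  Rbox∈⇒∈ : {g h : Ultrafilter W} → g ⊲ h → {B : Subset W} → Rbox B ∈ mem g → B ∈ mem h
  Rbox∈⇒∈ {g} {h} g⊲h {B} □B∈g with Ultrafilter.ultra h B
  ... | inj₁ B∈h  = B∈h
  ... | inj₂ ∁B∈h = ⊥-elim (Ultrafilter.proper g
          (Ultrafilter.upward g (Rinv∁∩Rbox⊆∅ B) (Ultrafilter.meet g (g⊲h (∁ B) ∁B∈h) □B∈g)))

  Rbox⊆RboxRbox : (A : Subset W) → Rbox A ⊆ Rbox (Rbox A)
  Rbox⊆RboxRbox A w∈□A y wRy z yRz = w∈□A z (R-trans wRy yRz)

  ≺-antitone : {f g : Ultrafilter W} {a b : Family W} → a ⊆ b → f ≺[ b ] g → f ≺[ a ] g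
  ≺-antitone a⊆b f≺g A Ss Ss⊆a = f≺g A Ss (All.map a⊆b Ss⊆a)

  ≺-⊲-trans : {f g h : Ultrafilter W} {a : Family W} → f ≺[ a ] g → g ⊲ h → f ≺[ a ] h
  ≺-⊲-trans {g = g} {h} f≺g g⊲h A Ss Ss⊆a Sinv∈f =
    let □A∈g = proj₂ (f≺g A Ss Ss⊆a Sinv∈f) in
    Rbox∈⇒∈ {g} {h} g⊲h □A∈g ,
    Rbox∈⇒∈ {g} {h} g⊲h (Ultrafilter.upward g (Rbox⊆RboxRbox A) □A∈g)

lemma5p8 : (F : VeltmanFrame) →
    let open VeltmanFrame F
        open Frame F
    in (f g h : Ultrafilter W) (a b : Family W) →
       ((a ⊆ b) → f ≺[ b ] g → f ≺[ a ] g)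
       × (f ≺[ a ] g → (∀ X → X ∈ Ultrafilter.mem h → Rinv X ∈ Ultrafilter.mem g) → f ≺[ a ] h)
lemma5p8 F f g h a b = ≺-antitone F {f} {g} , ≺-⊲-trans F {f} {g} {h}
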